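{- Let $p,p'$ be coprime integers with $1\le p<p'$. Let $0<a'<p'+p-1$ be such that both $a'$ and $a'+1$ are interfacial in the $(p,p'+p)$-model, and set $a=a'-\rho^{p,p'+p}(a')$. If $\rho^{p,p'+p}(a'+1)=\rho^{p,p'+p}(a')+1$, then $a$ is multifacial in the $(p,p')$-model.
   Context: For coprime positive integers $q<q'$: for $2\le a\le q'-2$, $a$ is interfacial in the $(q,q')$-model if $\lfloor (a+1)q/q'\rfloor=\lfloor (a-1)q/q'\rfloor+1$, and multifacial if $\lfloor (a+1)q/q'\rfloor=\lfloor (a-1)q/q'\rfloor+2$; moreover $0$ and $q'$ are always interfacial, $1$ and $q'-1$ are never interfacial, and $1$ and $q'-1$ are multifacial if and only if $q'<2q$. Also $\rho^{q,q'}(a)=\lfloor (a+1)q/q'\rfloor$. -}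

module Defs where

open import Data.Nat using (ℕ; zero; suc; _+_; _*_; _∸_; _≤_; _<_; _/_)
open import Data.Product using (_×_)
open import Data.Sum using (_⊎_)
open import Relation.Binary.PropositionalEquality using (_≡_)

-- ⌊ x / d ⌋ for natural numbers, with the (irrelevant) convention ⌊x/0⌋ = 0.
fdiv : ℕ → ℕ → ℕ
fdiv x zero    = 0
fdiv x (suc d) = x / suc d

ρ : ℕ → ℕ → ℕ → ℕ
ρ q q' a = fdiv ((a + 1) * q) q'

-- a is interfacial in the (q,q')-model (for 0 ≤ a ≤ q', as in the paper)
Interfacial : ℕ → ℕ → ℕ → Set
Interfacial q q' a =
    (a ≡ 0)
  ⊎ (a ≡ q')
  ⊎ ((2 ≤ a) × (a ≤ q' ∸ 2) ×
       (fdiv ((a + 1) * q) q' ≡ fdiv ((a ∸ 1) * q) q' + 1))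

Multifacial : ℕ → ℕ → ℕ → Set
Multifacial q q' a =
    (((a ≡ 1) ⊎ (a ≡ q' ∸ 1)) × (q' < 2 * q))
  ⊎ ((2 ≤ a) × (a ≤ q' ∸ 2) ×
       (fdiv ((a + 1) * q) q' ≡ fdiv ((a ∸ 1) * q) q' + 2))

{-# OPTIONS --safe #-}
-- Write Q = p' + p and r = ρ(a').  The hypotheses pin down four consecutive floors in the
-- (p,Q)-model: ⌊(a'−1)p/Q⌋ = r − 1, ⌊a'p/Q⌋ = ⌊(a'+1)p/Q⌋ = r and ⌊(a'+2)p/Q⌋ = r + 1.
-- Since t·Q ≤ x·p iff t·p' ≤ (x − t)·p (and likewise for <), the inequalities defining these
-- floors move to the (p,p')-model at the index x − t.  For a = a' − r they give
-- ⌊(a−1)p/p'⌋ = r − 1 and, using p < p', ⌊(a+1)p/p'⌋ = r + 1, a jump of two; the range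
-- 2 ≤ a ≤ p' − 2 follows from the same inequalities and a' + 1 ≤ Q − 2.
module Submission where

open import Defs
open import Data.Nat
open import Data.Nat.Properties
open import Data.Nat.DivMod using (m/n*n≤m; m<n*o⇒m/o<n; m*n/n≡m; /-monoˡ-≤; m≡m%n+[m/n]*n; m%n<n)
open import Data.Nat.Coprimality using (Coprime)
open import Data.Nat.Tactic.RingSolver using (solve-∀)
open import Data.Product using (_×_; _,_; proj₁; proj₂)
open import Data.Sum using (inj₁; inj₂)
open import Data.Empty using (⊥-elim)
open import Relation.Binary.PropositionalEquality

fdiv≡⇒*≤ : ∀ x d {j} → fdiv x d ≡ j → j * d ≤ x
fdiv≡⇒*≤ x zero    refl = z≤n
fdiv≡⇒*≤ x (suc d) refl = m/n*n≤m x (suc d)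

fdiv≡⇒<* : ∀ x d {j} → 0 < d → fdiv x d ≡ j → x < suc j * d
fdiv≡⇒<* x (suc d) _ refl = begin-strict
  x                             ≡⟨ m≡m%n+[m/n]*n x (suc d) ⟩
  x % suc d + x / suc d * suc d <⟨ +-monoˡ-< (x / suc d * suc d) (m%n<n x (suc d)) ⟩
  suc d + x / suc d * suc d     ∎
  where open ≤-Reasoning

fdiv-unique : ∀ x d {j} → j * d ≤ x → x < suc j * d → fdiv x d ≡ j
fdiv-unique x zero {j} _ x<0 = ⊥-elim (n≮0 (subst (x <_) (*-zeroʳ (suc j)) x<0))
fdiv-unique x (suc d) {j} lo hi = ≤-antisym
  (<⇒≤pred (m<n*o⇒m/o<n hi))
  (subst (_≤ x / suc d) (m*n/n≡m j (suc d)) (/-monoˡ-≤ (suc d) lo))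

interfacial-inner : ∀ {q q' a} → 0 < a → a < q' → Interfacial q q' a →
                    a ≤ q' ∸ 2 × fdiv ((a + 1) * q) q' ≡ fdiv ((a ∸ 1) * q) q' + 1
interfacial-inner ()  _    (inj₁ refl)
interfacial-inner _   a<q' (inj₂ (inj₁ refl))               = ⊥-elim (<-irrefl refl a<q')
interfacial-inner _   _    (inj₂ (inj₂ (_ , a≤q'∸2 , eq))) = a≤q'∸2 , eq

[1+m]*n≤o*p∧p<n⇒1+m<o : ∀ {m n o p} → suc m * n ≤ o * p → p < n → suc m < o
[1+m]*n≤o*p∧p<n⇒1+m<o {m} {n} {o} {p} le p<n = ≰⇒> λ o≤1+m → <⇒≱ (begin-strict
  o * p     ≤⟨ *-monoˡ-≤ p o≤1+m ⟩
  suc m * p <⟨ *-monoʳ-< (suc m) p<n ⟩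
  suc m * n ∎) le
  where open ≤-Reasoning

m*o<n*q∧m+n≤q+o⇒m<q : ∀ {m n o q} → m * o < n * q → m + n ≤ q + o → m < q
m*o<n*q∧m+n≤q+o⇒m<q {m} {n} {o} {q} lt le = ≰⇒> λ q≤m → <⇒≱ (begin-strict
  q + o ≤⟨ +-monoˡ-≤ o q≤m ⟩
  m + o <⟨ +-monoʳ-< m (o<n q≤m) ⟩
  m + n ∎) le
  where
  open ≤-Reasoning
  o<n : q ≤ m → o < n
  o<n q≤m = *-cancelˡ-< q o n (begin-strict
    q * o ≤⟨ *-monoˡ-≤ o q≤m ⟩
    m * o <⟨ lt ⟩
    n * q ≡⟨ *-comm n q ⟩
    q * n ∎)

module _ {m x : ℕ} (n p : ℕ) (m≤x : m ≤ x) where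
  private
    *-+-split : m * (n + p) ≡ m * p + m * n
    *-+-split = trans (cong (m *_) (+-comm n p)) (*-distribˡ-+ m p n)

    *-∸-split : x * p ≡ m * p + (x ∸ m) * p
    *-∸-split = trans (cong (_* p) (sym (m+[n∸m]≡n m≤x))) (*-distribʳ-+ p m (x ∸ m))

  shift-≤ : m * (n + p) ≤ x * p → m * n ≤ (x ∸ m) * p
  shift-≤ le = +-cancelˡ-≤ (m * p) (m * n) ((x ∸ m) * p)
    (subst₂ _≤_ *-+-split *-∸-split le)

  shift-< : x * p < m * (n + p) → (x ∸ m) * p < m * n
  shift-< lt = +-cancelˡ-< (m * p) ((x ∸ m) * p) (m * n)
    (subst₂ _<_ *-∸-split *-+-split lt)

multifacial-of-bounds : ∀ {p n s} e → p < n →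
  (e ∸ 1) * p < suc s * n → suc s * n ≤ e * p →
  e * p < suc (suc s) * n → suc (suc s) * n ≤ (e + 1) * p →
  (e + 1) + suc (suc (suc s)) ≤ n + p →
  Multifacial p n e
multifacial-of-bounds {s = s} zero p<n _ lo _ _ _ =
  ⊥-elim (n≮0 ([1+m]*n≤o*p∧p<n⇒1+m<o {m = s} {o = 0} lo p<n))
multifacial-of-bounds {p} {n} {s} (suc e) p<n hi₋ lo hi lo₊ bound =
  inj₂ (2≤1+e , 1+e≤n∸2 , trans floor₊ (trans (+-comm 2 s) (cong (_+ 2) (sym floor₋))))
  where
  open ≤-Reasoning
  2≤1+e : 2 ≤ suc e
  2≤1+e = ≤-trans (s≤s (s≤s z≤n)) ([1+m]*n≤o*p∧p<n⇒1+m<o {m = s} {o = suc e} lo p<n)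

  lo₋ : s * n ≤ e * p
  lo₋ = <⇒≤ (+-cancelˡ-< p (s * n) (e * p) (<-≤-trans (+-monoˡ-< (s * n) p<n) lo))

  hi₊ : (suc e + 1) * p < suc (suc (suc s)) * n
  hi₊ = begin-strict
    (suc e + 1) * p      ≡⟨ cong (_* p) (+-comm (suc e) 1) ⟩
    p + suc e * p        ≡⟨ +-comm p (suc e * p) ⟩
    suc e * p + p        <⟨ +-mono-< hi p<n ⟩
    suc (suc s) * n + n  ≡⟨ +-comm (suc (suc s) * n) n ⟩
    suc (suc (suc s)) * n ∎

  floor₋ : fdiv (e * p) n ≡ s
  floor₋ = fdiv-unique (e * p) n lo₋ hi₋

  floor₊ : fdiv ((suc e + 1) * p) n ≡ suc (suc s)
  floor₊ = fdiv-unique ((suc e + 1) * p) n lo₊ hi₊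

  1+e≤n∸2 : suc e ≤ n ∸ 2
  1+e≤n∸2 = m+n≤o⇒m≤o∸n (suc e)
    (subst (_≤ n) (cong suc (sym (+-suc e 1))) (m*o<n*q∧m+n≤q+o⇒m<q hi₊ bound))

multifacial-of-[n+p]-bounds : ∀ {p n s} a → p < n →
  (a ∸ 1) * p < suc s * (n + p) → suc s * (n + p) ≤ a * p →
  (a + 1) * p < suc (suc s) * (n + p) → suc (suc s) * (n + p) ≤ (a + 1 + 1) * p →
  a + 1 ≤ n + p ∸ 2 →
  Multifacial p n (a ∸ suc s)
multifacial-of-[n+p]-bounds {p} {n} {s} a p<n hi₋ lo hi lo₊ a+1≤Q∸2 = multifacial-of-bounds e p<n
  (subst (λ i → i * p < suc s * n) [a∸1]∸[1+s]≡e∸1 (shift-< n p 1+s≤a∸1 hi₋))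
  (shift-≤ n p 1+s≤a lo)
  (subst (λ i → i * p < suc (suc s) * n) [a+1]∸[2+s]≡e (shift-< n p 2+s≤a+1 hi))
  (subst (λ i → suc (suc s) * n ≤ i * p) [a+2]∸[2+s]≡e+1 (shift-≤ n p 2+s≤a+2 lo₊))
  (subst (_≤ n + p) [a+1]+2≡[e+1]+[3+s] (m≤o∸n⇒m+n≤o (a + 1) 2≤Q a+1≤Q∸2))
  where
  e = a ∸ suc s

  1+s<a : suc s < a
  1+s<a = [1+m]*n≤o*p∧p<n⇒1+m<o {m = s} {o = a} lo (m<n+m p (≤-trans (s≤s z≤n) p<n))
  1+s≤a : suc s ≤ a
  1+s≤a = <⇒≤ 1+s<a
  1+s≤a∸1 : suc s ≤ a ∸ 1
  1+s≤a∸1 = ∸-monoˡ-≤ 1 1+s<a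
  2+s≤a+1 : suc (suc s) ≤ a + 1
  2+s≤a+1 = ≤-trans 1+s<a (m≤m+n a 1)
  2+s≤a+2 : suc (suc s) ≤ a + 1 + 1
  2+s≤a+2 = ≤-trans 2+s≤a+1 (m≤m+n (a + 1) 1)
  2≤Q : 2 ≤ n + p
  2≤Q = ≤-trans (≤-trans (s≤s (s≤s z≤n)) 2+s≤a+1) (≤-trans a+1≤Q∸2 (m∸n≤m (n + p) 2))

  [a∸1]∸[1+s]≡e∸1 : a ∸ 1 ∸ suc s ≡ e ∸ 1
  [a∸1]∸[1+s]≡e∸1 = trans (∸-+-assoc a 1 (suc s))
    (trans (cong (a ∸_) (+-comm 1 (suc s))) (sym (∸-+-assoc a (suc s) 1)))
  [a+1]∸[2+s]≡e : a + 1 ∸ suc (suc s) ≡ e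
  [a+1]∸[2+s]≡e = cong (_∸ suc (suc s)) (+-comm a 1)
  [a+2]∸[2+s]≡e+1 : a + 1 + 1 ∸ suc (suc s) ≡ e + 1
  [a+2]∸[2+s]≡e+1 = trans (cong (_∸ suc (suc s)) (+-comm (a + 1) 1)) (+-∸-comm 1 1+s≤a)
  [a+1]+2≡[e+1]+[3+s] : a + 1 + 2 ≡ (e + 1) + suc (suc (suc s))
  [a+1]+2≡[e+1]+[3+s] = trans (cong (λ i → i + 1 + 2) (sym (m+[n∸m]≡n 1+s≤a))) (reorder s e)
    where
    reorder : ∀ s e → suc s + e + 1 + 2 ≡ (e + 1) + suc (suc (suc s))
    reorder = solve-∀

multifacial-of-[n+p]-floors : ∀ {p n s} a → p < n →
  fdiv ((a ∸ 1) * p) (n + p) ≡ s → fdiv (a * p) (n + p) ≡ suc s →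
  fdiv ((a + 1) * p) (n + p) ≡ suc s → fdiv ((a + 1 + 1) * p) (n + p) ≡ suc (suc s) →
  a + 1 ≤ n + p ∸ 2 →
  Multifacial p n (a ∸ fdiv ((a + 1) * p) (n + p))
multifacial-of-[n+p]-floors {p} {n} a p<n floor₋ floor₀ floor₁ floor₂ bound =
  subst (λ r → Multifacial p n (a ∸ r)) (sym floor₁)
    (multifacial-of-[n+p]-bounds a p<n
      (fdiv≡⇒<* ((a ∸ 1) * p) (n + p) 0<Q floor₋) (fdiv≡⇒*≤ (a * p) (n + p) floor₀)
      (fdiv≡⇒<* ((a + 1) * p) (n + p) 0<Q floor₁) (fdiv≡⇒*≤ ((a + 1 + 1) * p) (n + p) floor₂)
      bound)
  where
  0<Q : 0 < n + p
  0<Q = ≤-trans (≤-<-trans z≤n p<n) (m≤m+n n p)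

lemmaC5 : (p p' a' : ℕ) → Coprime p p' → 1 ≤ p → p < p' →
          0 < a' → a' < p' + p ∸ 1 →
          Interfacial p (p' + p) a' → Interfacial p (p' + p) (a' + 1) →
          ρ p (p' + p) (a' + 1) ≡ ρ p (p' + p) a' + 1 →
          Multifacial p p' (a' ∸ ρ p (p' + p) a')
lemmaC5 p p' a' _ _ p<p' 0<a' a'<Q∸1 I₁ I₂ ρ-step =
  multifacial-of-[n+p]-floors a' p<p' refl floor[a'] floor[a'+1] floor[a'+2] (proj₁ inner₂)
  where
  Q = p' + p
  s = fdiv ((a' ∸ 1) * p) Q

  a'+1<Q : a' + 1 < Q
  a'+1<Q = m≤o∸n⇒m+n≤o (suc a') (≤-trans (≤-<-trans z≤n p<p') (m≤m+n p' p)) a'<Q∸1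
  inner₁ : a' ≤ Q ∸ 2 × ρ p Q a' ≡ s + 1
  inner₁ = interfacial-inner 0<a' (≤-trans (m≤m+n (suc a') 1) a'+1<Q) I₁
  inner₂ : a' + 1 ≤ Q ∸ 2 × ρ p Q (a' + 1) ≡ fdiv ((a' + 1 ∸ 1) * p) Q + 1
  inner₂ = interfacial-inner (≤-trans 0<a' (m≤m+n a' 1)) a'+1<Q I₂

  floor[a'+1] : ρ p Q a' ≡ suc s
  floor[a'+1] = trans (proj₂ inner₁) (+-comm s 1)
  floor[a'] : fdiv (a' * p) Q ≡ suc s
  floor[a'] = trans (cong (λ i → fdiv (i * p) Q) (sym (m+n∸n≡m a' 1)))
    (trans (+-cancelʳ-≡ 1 _ _ (trans (sym (proj₂ inner₂)) ρ-step)) floor[a'+1])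
  floor[a'+2] : fdiv ((a' + 1 + 1) * p) Q ≡ suc (suc s)
  floor[a'+2] = trans ρ-step (trans (cong (_+ 1) floor[a'+1]) (+-comm (suc s) 1))
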